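{- Let $\pi\in\mathcal D(n)$. Then for every integer $x$ with $\mathbf a(\pi)+\mathbf b(\pi)\le x\le\binom n2$ there exists $\tau\in\mathcal D(n)$ with $\mathbf a(\tau)+\mathbf b(\tau)=x$.
   Context: A Dyck path of semilength $n$ is a lattice path from $(0,0)$ to $(n,n)$ with unit north and east steps never going below $y=x$; $\mathcal D(n)$ is their set. The area $\mathbf a(\pi)$ is the number of whole unit cells between $\pi$ and the diagonal. With $h_i$ the $y$-coordinate of the east step of $\pi$ in column $i$ (strip $i-1\le x\le i$), the bounce points are $b_0=0$, $b_k=h_{b_{k-1}+1}$ until $b_m=n$, and the bounce is $\mathbf b(\pi)=\sum_{k=1}^m(n-b_k)$. -}

module Defs where

open import Data.Nat using (ℕ; zero; suc; _+_; _∸_; _≤?_)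
open import Data.List using (List; []; _∷_; length; sum)
open import Data.Empty using (⊥)
open import Data.Product using (_×_)
open import Relation.Binary.PropositionalEquality using (_≡_)
open import Relation.Nullary using (yes; no)

-- Unit steps of a lattice path: N = north (0,1), E = east (1,0).
data Step : Set where
  N E : Step

-- Never-below-diagonal condition, tracked by current height y - x = h,
-- ending on the diagonal.
Balanced : ℕ → List Step → Set
Balanced h []            = h ≡ 0
Balanced h (N ∷ s)       = Balanced (suc h) s
Balanced zero (E ∷ s)    = ⊥
Balanced (suc h) (E ∷ s) = Balanced h s

IsDyck : ℕ → List Step → Set
IsDyck n π = (length π ≡ n + n) × Balanced 0 π

-- heights-from y π: list of y-coordinates of the east steps of π, in
-- order (the i-th entry, 1-based, is h_i), y the current y-coordinate.
heights-from : ℕ → List Step → List ℕ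
heights-from y []      = []
heights-from y (N ∷ s) = heights-from (suc y) s
heights-from y (E ∷ s) = y ∷ heights-from y s

heights : List Step → List ℕ
heights = heights-from 0

-- area: column i (1-based) contributes h_i - i whole cells.
area-from : ℕ → List ℕ → ℕ
area-from i []       = 0
area-from i (h ∷ hs) = (h ∸ suc i) + area-from (suc i) hs

area : List Step → ℕ
area π = area-from 0 (heights π)

-- 0-based lookup with default 0: nth hs j = h_{j+1}.
nth : List ℕ → ℕ → ℕ
nth []       _       = 0
nth (h ∷ hs) zero    = h
nth (h ∷ hs) (suc j) = nth hs j

-- For a Dyck path bounce points strictly increase, so fuel n suffices.
bounce-go : ℕ → ℕ → List ℕ → ℕ → ℕ
bounce-go zero     n hs b = 0
bounce-go (suc f)  n hs b with n ≤? b
... | yes _ = 0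
... | no  _ = (n ∸ nth hs b) + bounce-go f n hs (nth hs b)

bounce : ℕ → List Step → ℕ
bounce n π = bounce-go n n (heights π) 0

{-# OPTIONS --safe #-}
-- If π is not NⁿEⁿ, turning its last valley E N into a peak N E adds one
-- cell of area and does not increase the bounce: the bounce path either
-- misses the modified column, or bounces from it to y + 1 instead of y and
-- then straight to n, because every later east step lies at height n.
-- So along these moves a + b rises by at most one while the area strictly
-- increases, and the moves end at NⁿEⁿ, where a + b = n C 2. A discrete
-- intermediate value argument then hits every x in between.
module Submission where

open import Defs
open import Data.Nat using (ℕ; zero; suc; _+_; _∸_; _≤_; _<_; z≤n; s≤s; _≤?_; _≟_; ⌊_/2⌋)
open import Data.Nat.Properties
open import Data.Nat.Combinatorics using (_C_; nC1≡n; nCk+nC[k+1]≡[n+1]C[k+1])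
open import Data.List using (List; []; _∷_; _++_; length; replicate)
open import Data.List.Properties using (length-++)
open import Data.Product using (_×_; _,_; proj₁; proj₂; ∃-syntax)
open import Data.Sum using (_⊎_; inj₁; inj₂)
open import Relation.Nullary using (yes; no; contradiction)
open import Relation.Binary.PropositionalEquality
  using (_≡_; _≢_; refl; sym; trans; cong; cong₂; subst; module ≡-Reasoning)

module _ {a p} {A : Set a} (P : A → Set p) (stat pot : A → ℕ) (top : ℕ)
         (pot≤stat : ∀ σ → P σ → pot σ ≤ stat σ)
         (climb : ∀ σ → P σ →
                  top ≤ stat σ ⊎ ∃[ σ′ ] (P σ′ × pot σ < pot σ′ × stat σ′ ≤ suc (stat σ)))
         where

  private
    reach : ∀ fuel σ → P σ → ∀ x → stat σ ≤ x → x ≤ top → x ≤ pot σ + fuel →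
            ∃[ τ ] (P τ × stat τ ≡ x)
    reach fuel σ Pσ x lo hi enough with stat σ ≟ x
    ... | yes stat≡x = σ , Pσ , stat≡x
    ... | no stat≢x with ≤∧≢⇒< lo stat≢x | climb σ Pσ | fuel
    ...   | stat<x | inj₁ top≤stat | _ = contradiction (≤-trans hi top≤stat) (<⇒≱ stat<x)
    ...   | stat<x | inj₂ _        | zero =
      contradiction (≤-trans enough (≤-trans (≤-reflexive (+-identityʳ _)) (pot≤stat σ Pσ)))
                    (<⇒≱ stat<x)
    ...   | stat<x | inj₂ (σ′ , Pσ′ , pot< , stat≤) | suc fuel′ =
      reach fuel′ σ′ Pσ′ x (≤-trans stat≤ stat<x) hi
            (≤-trans enough (≤-trans (≤-reflexive (+-suc (pot σ) fuel′)) (+-monoˡ-≤ fuel′ pot<)))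

  discrete-intermediate-value : ∀ σ → P σ → ∀ x → stat σ ≤ x → x ≤ top →
                                ∃[ τ ] (P τ × stat τ ≡ x)
  discrete-intermediate-value σ Pσ x lo hi = reach x σ Pσ x lo hi (m≤n+m x (pot σ))

#N #E : List Step → ℕ
#N []      = 0
#N (N ∷ s) = suc (#N s)
#N (E ∷ s) = #N s

#E []      = 0
#E (N ∷ s) = #E s
#E (E ∷ s) = suc (#E s)

#N-++ : ∀ u w → #N (u ++ w) ≡ #N u + #N w
#N-++ []      w = refl
#N-++ (N ∷ u) w = cong suc (#N-++ u w)
#N-++ (E ∷ u) w = #N-++ u w

#E-++ : ∀ u w → #E (u ++ w) ≡ #E u + #E w
#E-++ []      w = refl
#E-++ (N ∷ u) w = #E-++ u w
#E-++ (E ∷ u) w = cong suc (#E-++ u w)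

length≡#N+#E : ∀ s → length s ≡ #N s + #E s
length≡#N+#E []      = refl
length≡#N+#E (N ∷ s) = cong suc (length≡#N+#E s)
length≡#N+#E (E ∷ s) = trans (cong suc (length≡#N+#E s)) (sym (+-suc (#N s) (#E s)))

Balanced⇒#E≡h+#N : ∀ h s → Balanced h s → #E s ≡ h + #N s
Balanced⇒#E≡h+#N h       []      bal = trans (sym bal) (sym (+-identityʳ h))
Balanced⇒#E≡h+#N h       (N ∷ s) bal = trans (Balanced⇒#E≡h+#N (suc h) s bal) (sym (+-suc h (#N s)))
Balanced⇒#E≡h+#N (suc h) (E ∷ s) bal = cong suc (Balanced⇒#E≡h+#N h s bal)

IsDyck⇒#N≡n×#E≡n : ∀ {n} π → IsDyck n π → #N π ≡ n × #E π ≡ n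
IsDyck⇒#N≡n×#E≡n {n} π (len , bal) = #N≡n , trans #E≡#N #N≡n
  where
  #E≡#N : #E π ≡ #N π
  #E≡#N = Balanced⇒#E≡h+#N 0 π bal

  #N≡n : #N π ≡ n
  #N≡n = begin
    #N π                 ≡⟨ n≡⌊n+n/2⌋ (#N π) ⟩
    ⌊ #N π + #N π /2⌋    ≡⟨ cong (λ e → ⌊ #N π + e /2⌋) (sym #E≡#N) ⟩
    ⌊ #N π + #E π /2⌋    ≡⟨ cong ⌊_/2⌋ (trans (sym (length≡#N+#E π)) len) ⟩
    ⌊ n + n /2⌋          ≡⟨ sym (n≡⌊n+n/2⌋ n) ⟩
    n                    ∎
    where open ≡-Reasoning

Balanced-before-E : ∀ h u {w} → Balanced h (u ++ E ∷ w) → #E u < h + #N u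
Balanced-before-E (suc h) []      _   = s≤s z≤n
Balanced-before-E h       (N ∷ u) bal =
  subst (#E u <_) (sym (+-suc h (#N u))) (Balanced-before-E (suc h) u bal)
Balanced-before-E (suc h) (E ∷ u) bal = s≤s (Balanced-before-E h u bal)

Balanced-swap : ∀ h u w → Balanced h (u ++ E ∷ N ∷ w) → Balanced h (u ++ N ∷ E ∷ w)
Balanced-swap (suc h) []      w bal = bal
Balanced-swap h       (N ∷ u) w bal = Balanced-swap (suc h) u w bal
Balanced-swap (suc h) (E ∷ u) w bal = Balanced-swap h u w bal

IsDyck-swap : ∀ {n} u w → IsDyck n (u ++ E ∷ N ∷ w) → IsDyck n (u ++ N ∷ E ∷ w)
IsDyck-swap u w (len , bal) =
  trans (length-++ u) (trans (sym (length-++ u)) len) , Balanced-swap 0 u w bal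

peak : ℕ → ℕ → List Step
peak a b = replicate a N ++ replicate b E

#N-peak : ∀ a b → #N (peak a b) ≡ a
#N-peak (suc a) b    = cong suc (#N-peak a b)
#N-peak zero    zero    = refl
#N-peak zero    (suc b) = #N-peak zero b

#E-peak : ∀ a b → #E (peak a b) ≡ b
#E-peak (suc a) b    = #E-peak a b
#E-peak zero    zero    = refl
#E-peak zero    (suc b) = cong suc (#E-peak zero b)

data LastValley : List Step → Set where
  no-valley : ∀ a b → LastValley (peak a b)
  valley    : ∀ u a b → LastValley (u ++ E ∷ N ∷ peak a b)

lastValley : ∀ π → LastValley π
lastValley []      = no-valley 0 0
lastValley (s ∷ π) with lastValley π
lastValley (N ∷ _) | no-valley a b       = no-valley (suc a) b
lastValley (E ∷ _) | no-valley zero b    = no-valley 0 (suc b)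
lastValley (E ∷ _) | no-valley (suc a) b = valley [] a b
lastValley (s ∷ _) | valley u a b        = valley (s ∷ u) a b

length-heights-from : ∀ y s → length (heights-from y s) ≡ #E s
length-heights-from y []      = refl
length-heights-from y (N ∷ s) = length-heights-from (suc y) s
length-heights-from y (E ∷ s) = cong suc (length-heights-from y s)

heights-from-++ : ∀ y u w → heights-from y (u ++ w) ≡ heights-from y u ++ heights-from (y + #N u) w
heights-from-++ y []      w = cong (λ z → heights-from z w) (sym (+-identityʳ y))
heights-from-++ y (N ∷ u) w =
  trans (heights-from-++ (suc y) u w)
        (cong (λ z → heights-from (suc y) u ++ heights-from z w) (sym (+-suc y (#N u))))
heights-from-++ y (E ∷ u) w = cong (y ∷_) (heights-from-++ y u w)

heights-from-peak : ∀ y a b → heights-from y (peak a b) ≡ replicate b (y + a)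
heights-from-peak y (suc a) b =
  trans (heights-from-peak (suc y) a b) (cong (replicate b) (sym (+-suc y a)))
heights-from-peak y zero    b = trans (heights-from-Eᵇ b) (cong (replicate b) (sym (+-identityʳ y)))
  where
  heights-from-Eᵇ : ∀ b → heights-from y (replicate b E) ≡ replicate b y
  heights-from-Eᵇ zero    = refl
  heights-from-Eᵇ (suc b) = cong (y ∷_) (heights-from-Eᵇ b)

area-from-replicate : ∀ k i → area-from i (replicate k (i + k)) ≡ k C 2
area-from-replicate zero    i = refl
area-from-replicate (suc k) i
  rewrite +-suc i k | m+n∸m≡n (suc i) k | area-from-replicate k (suc i) =
  trans (cong (_+ k C 2) (sym (nC1≡n k))) (nCk+nC[k+1]≡[n+1]C[k+1] k 1)

area-peak : ∀ {n} a b → IsDyck n (peak a b) → area (peak a b) ≡ n C 2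
area-peak {n} a b dyck = begin
  area-from 0 (heights (peak a b)) ≡⟨ cong (area-from 0) (heights-from-peak 0 a b) ⟩
  area-from 0 (replicate b a)      ≡⟨ cong₂ (λ k m → area-from 0 (replicate k m)) b≡n a≡n ⟩
  area-from 0 (replicate n n)      ≡⟨ area-from-replicate n 0 ⟩
  n C 2                            ∎
  where
  open ≡-Reasoning
  a≡n : a ≡ n
  a≡n = trans (sym (#N-peak a b)) (proj₁ (IsDyck⇒#N≡n×#E≡n (peak a b) dyck))
  b≡n : b ≡ n
  b≡n = trans (sym (#E-peak a b)) (proj₂ (IsDyck⇒#N≡n×#E≡n (peak a b) dyck))

area-from-bump : ∀ i H {y} T → i + length H < y →
                 area-from i (H ++ suc y ∷ T) ≡ suc (area-from i (H ++ y ∷ T))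
area-from-bump i []      {y} T i<y =
  cong (_+ area-from (suc i) T) (+-∸-assoc 1 (subst (_< y) (+-identityʳ i) i<y))
area-from-bump i (h ∷ H) {y} T i+H<y =
  trans (cong ((h ∸ suc i) +_)
              (area-from-bump (suc i) H T (subst (_< y) (+-suc i (length H)) i+H<y)))
        (+-suc (h ∸ suc i) _)

area-swap : ∀ u w → Balanced 0 (u ++ E ∷ N ∷ w) →
            area (u ++ N ∷ E ∷ w) ≡ suc (area (u ++ E ∷ N ∷ w))
area-swap u w bal
  rewrite heights-from-++ 0 u (E ∷ N ∷ w) | heights-from-++ 0 u (N ∷ E ∷ w) =
  area-from-bump 0 (heights u) (heights-from (suc (#N u)) w)
    (subst (_< #N u) (sym (length-heights-from 0 u)) (Balanced-before-E 0 u bal))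

nth-middle : ∀ H z T → nth (H ++ z ∷ T) (length H) ≡ z
nth-middle []      z T = refl
nth-middle (h ∷ H) z T = nth-middle H z T

nth-off-middle : ∀ H z z′ T {j} → j ≢ length H → nth (H ++ z ∷ T) j ≡ nth (H ++ z′ ∷ T) j
nth-off-middle []      z z′ T {zero}  j≢0 = contradiction refl j≢0
nth-off-middle []      z z′ T {suc j} _   = refl
nth-off-middle (h ∷ H) z z′ T {zero}  _   = refl
nth-off-middle (h ∷ H) z z′ T {suc j} j≢  = nth-off-middle H z z′ T (λ eq → j≢ (cong suc eq))

nth-replicate : ∀ {k m j} → j < k → nth (replicate k m) j ≡ m
nth-replicate {suc k} {j = zero}  _          = refl
nth-replicate {suc k} {j = suc j} (s≤s j<k) = nth-replicate j<k

nth-after-middle : ∀ H z {k m j} → length H < j → j ≤ length H + k →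
                   nth (H ++ z ∷ replicate k m) j ≡ m
nth-after-middle []      z {j = suc j} _         j<k = nth-replicate j<k
nth-after-middle (h ∷ H) z {j = suc j} (s≤s H<j) j≤ = nth-after-middle H z H<j (≤-pred j≤)

bounce-go-finish : ∀ f n hs b → (b < n → nth hs b ≡ n) → bounce-go f n hs b ≡ 0
bounce-go-finish zero    n hs b _    = refl
bounce-go-finish (suc f) n hs b jump with n ≤? b
... | yes _   = refl
... | no n≰b rewrite jump (≰⇒> n≰b) | n∸n≡0 n =
  bounce-go-finish f n hs n (λ n<n → contradiction n<n (n≮n n))

bounce-go-bump : ∀ f n H {y} T → (suc y < n → nth (H ++ suc y ∷ T) (suc y) ≡ n) →
                 ∀ b → bounce-go f n (H ++ suc y ∷ T) b ≤ bounce-go f n (H ++ y ∷ T) b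
bounce-go-bump zero    n H     T jump b = z≤n
bounce-go-bump (suc f) n H {y} T jump b with n ≤? b
... | yes _ = z≤n
... | no _ with b ≟ length H
...   | yes refl
  rewrite nth-middle H (suc y) T | nth-middle H y T
        | bounce-go-finish f n (H ++ suc y ∷ T) (suc y) jump =
  ≤-trans (≤-reflexive (+-identityʳ _)) (≤-trans (∸-monoʳ-≤ n (n≤1+n y)) (m≤m+n _ _))
...   | no b≢H rewrite nth-off-middle H (suc y) y T b≢H =
  +-monoʳ-≤ _ (bounce-go-bump f n H T jump _)

bounce-swap-last-valley : ∀ {n} u a b → IsDyck n (u ++ E ∷ N ∷ peak a b) →
                          bounce n (u ++ N ∷ E ∷ peak a b) ≤ bounce n (u ++ E ∷ N ∷ peak a b)
bounce-swap-last-valley {n} u a b dyck@(_ , bal) = begin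
  bounce-go n n (heights τ) 0                  ≡⟨ cong (λ hs → bounce-go n n hs 0) heights-τ ⟩
  bounce-go n n (H ++ suc y ∷ replicate b n) 0 ≤⟨ bounce-go-bump n n H (replicate b n) jump 0 ⟩
  bounce-go n n (H ++ y ∷ replicate b n) 0     ≡⟨ cong (λ hs → bounce-go n n hs 0) heights-π ⟨
  bounce-go n n (heights π) 0                  ∎
  where
  open ≤-Reasoning
  π τ : List Step
  π = u ++ E ∷ N ∷ peak a b
  τ = u ++ N ∷ E ∷ peak a b
  y : ℕ
  y = #N u
  H : List ℕ
  H = heights u

  peak-height≡n : suc (y + a) ≡ n
  peak-height≡n = begin-equality
    suc (y + a)                  ≡⟨ +-suc y a ⟨
    y + suc a                    ≡⟨ cong (λ k → y + suc k) (#N-peak a b) ⟨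
    y + #N (E ∷ N ∷ peak a b)    ≡⟨ #N-++ u _ ⟨
    #N π                         ≡⟨ proj₁ (IsDyck⇒#N≡n×#E≡n π dyck) ⟩
    n                            ∎

  width≡n : length H + suc b ≡ n
  width≡n = begin-equality
    length H + suc b             ≡⟨ cong₂ (λ k l → k + suc l) (length-heights-from 0 u) (sym (#E-peak a b)) ⟩
    #E u + #E (E ∷ N ∷ peak a b) ≡⟨ #E-++ u _ ⟨
    #E π                         ≡⟨ proj₂ (IsDyck⇒#N≡n×#E≡n π dyck) ⟩
    n                            ∎

  later-heights≡n : heights-from (suc y) (peak a b) ≡ replicate b n
  later-heights≡n = trans (heights-from-peak (suc y) a b) (cong (replicate b) peak-height≡n)

  heights-π : heights π ≡ H ++ y ∷ replicate b n
  heights-π = trans (heights-from-++ 0 u _) (cong (λ T → H ++ y ∷ T) later-heights≡n)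

  heights-τ : heights τ ≡ H ++ suc y ∷ replicate b n
  heights-τ = trans (heights-from-++ 0 u _) (cong (λ T → H ++ suc y ∷ T) later-heights≡n)

  jump : suc y < n → nth (H ++ suc y ∷ replicate b n) (suc y) ≡ n
  jump sy<n = nth-after-middle H (suc y) H<sy (≤-pred (subst (suc y <_) n≡ sy<n))
    where
    H<sy : length H < suc y
    H<sy = m<n⇒m<1+n (subst (_< y) (sym (length-heights-from 0 u)) (Balanced-before-E 0 u bal))
    n≡ : n ≡ suc (length H + b)
    n≡ = trans (sym width≡n) (+-suc (length H) b)

lemma5p3 : (n : ℕ) (π : List Step) → IsDyck n π →
           (x : ℕ) → area π + bounce n π ≤ x → x ≤ n C 2 →
           ∃[ τ ] (IsDyck n τ × area τ + bounce n τ ≡ x)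
lemma5p3 n = discrete-intermediate-value (IsDyck n) stat area (n C 2) (λ σ _ → m≤m+n _ _) climb
  where
  stat : List Step → ℕ
  stat σ = area σ + bounce n σ

  climb : ∀ σ → IsDyck n σ →
          n C 2 ≤ stat σ ⊎ ∃[ σ′ ] (IsDyck n σ′ × area σ < area σ′ × stat σ′ ≤ suc (stat σ))
  climb σ dyck with lastValley σ
  ... | no-valley a b = inj₁ (subst (_≤ stat σ) (area-peak {n} a b dyck) (m≤m+n _ _))
  ... | valley u a b  = inj₂ (τ , IsDyck-swap {n} u _ dyck , ≤-reflexive (sym area≡) , stat≤)
    where
    τ : List Step
    τ = u ++ N ∷ E ∷ peak a b
    area≡ : area τ ≡ suc (area σ)
    area≡ = area-swap u (peak a b) (proj₂ dyck)
    stat≤ : stat τ ≤ suc (stat σ)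
    stat≤ = subst (λ A → A + bounce n τ ≤ suc (stat σ)) (sym area≡)
                  (s≤s (+-monoʳ-≤ (area σ) (bounce-swap-last-valley {n} u a b dyck)))
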